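{- For every integer $n \ge 4$ with $n \equiv 1,4,6 \pmod{7}$, there exists a binary LCD $[n,3,\lfloor 4n/7 \rfloor - 1]$ code.
   Context: All codes are binary linear codes; an $[n,k,d]$ code is a $k$-dimensional subspace of $\mathbb{F}_2^n$ with minimum nonzero Hamming weight $d$. A code $C$ is LCD if $C \cap C^\perp = \{\mathbf{0}_n\}$, where $C^\perp$ is the dual with respect to the standard inner product. -}

module Defs where

open import Data.Bool using (Bool; true; false; _xor_; _∧_)
open import Data.Nat using (ℕ; zero; suc; _+_; _≤_)
open import Data.Vec using (Vec; []; _∷_; zipWith; replicate; foldr)
open import Data.Product using (Σ; ∃; _×_; _,_)
open import Relation.Binary.PropositionalEquality using (_≡_)
open import Relation.Nullary using (¬_)

-- Vectors of F₂ⁿ, with F₂ = Bool (false = 0, true = 1, xor = +, ∧ = ·).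
Word : ℕ → Set
Word n = Vec Bool n

0ᵥ : (n : ℕ) → Word n
0ᵥ n = replicate n false

_⊕_ : {n : ℕ} → Word n → Word n → Word n
_⊕_ = zipWith _xor_

_·ₛ_ : {n : ℕ} → Bool → Word n → Word n
false ·ₛ v = replicate _ false
true  ·ₛ v = v

⟨_,_⟩ : {n : ℕ} → Word n → Word n → Bool
⟨ [] , [] ⟩ = false
⟨ a ∷ u , b ∷ v ⟩ = (a ∧ b) xor ⟨ u , v ⟩

wt : {n : ℕ} → Word n → ℕ
wt [] = 0
wt (true ∷ v) = suc (wt v)
wt (false ∷ v) = wt v

GenMatrix : ℕ → ℕ → Set
GenMatrix k n = Vec (Word n) k

comb : {k n : ℕ} → Word k → GenMatrix k n → Word n
comb {n = n} [] [] = 0ᵥ n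
comb (c ∷ cs) (g ∷ gs) = (c ·ₛ g) ⊕ comb cs gs

-- rows are linearly independent, so the code spanned has dimension exactly k
LinIndep : {k n : ℕ} → GenMatrix k n → Set
LinIndep {k} {n} G = (c : Word k) → comb c G ≡ 0ᵥ n → c ≡ 0ᵥ k

_∈C_ : {k n : ℕ} → Word n → GenMatrix k n → Set
_∈C_ {k} x G = ∃ λ (c : Word k) → comb c G ≡ x

_∈C⊥_ : {k n : ℕ} → Word n → GenMatrix k n → Set
y ∈C⊥ G = ∀ x → x ∈C G → ⟨ y , x ⟩ ≡ false

MinDist : {k n : ℕ} → GenMatrix k n → ℕ → Set
MinDist {k} {n} G d =
  (Σ (Word n) λ x → x ∈C G × ¬ (x ≡ 0ᵥ n) × wt x ≡ d)
  × (∀ x → x ∈C G → ¬ (x ≡ 0ᵥ n) → d ≤ wt x)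

IsLCD : {k n : ℕ} → GenMatrix k n → Set
IsLCD {k} {n} G = ∀ x → x ∈C G → x ∈C⊥ G → x ≡ 0ᵥ n

IsLCDCode : (n k d : ℕ) → GenMatrix k n → Set
IsLCDCode n k d G = LinIndep G × MinDist G d × IsLCD G

-- The simplex code S₃ is a [7,3,4] code all of whose nonzero codewords have weight 4, and it
-- is self-orthogonal. Juxtaposing m copies of a generator matrix of S₃ to a generator matrix
-- of an LCD [b,3,d] code therefore adds exactly 4m to the weight of every nonzero codeword and
-- leaves all inner products between codewords unchanged, giving an LCD [b+7m,3,d+4m] code.
-- Since ⌊4(b+7m)/7⌋ = ⌊4b/7⌋ + 4m, it suffices to start from LCD [b,3,⌊4b/7⌋−1] codes with
-- b = 4, 6, 8, which cover the residues 4, 6, 1 modulo 7; these are checked exhaustively.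
module Submission where

open import Defs
open import Data.Nat using (ℕ; _≤_; _*_; _∸_; _/_; _%_)
open import Data.Sum using (_⊎_)
open import Data.Product using (Σ)
open import Relation.Binary.PropositionalEquality using (_≡_)

open import Data.Bool using (true; false; _xor_; _∧_)
open import Data.Bool.Properties using (xor-assoc)
import Data.Bool.Properties as Bool
open import Data.Nat using (zero; suc; _+_; s≤s; NonZero)
open import Data.Nat.Properties using (+-mono-≤; ≤-reflexive; *-distribˡ-+; *-assoc; *-comm)
import Data.Nat.Properties as ℕ
open import Data.Nat.DivMod using (m≡m%n+[m/n]*n; +-distrib-/-∣ʳ; m*n/n≡m)
open import Data.Nat.Divisibility using (divides-refl)
open import Data.Product using (∃; _×_; _,_)
open import Data.Sum using (inj₁; inj₂; [_,_]′)
open import Data.Vec using ([]; _∷_; _++_; zipWith; replicate)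
open import Data.Vec.Properties using (≡-dec; zipWith-++; ++-injectiveˡ)
open import Function using (_∘_)
open import Relation.Binary.PropositionalEquality using (_≢_; refl; sym; trans; cong; cong₂; subst; module ≡-Reasoning)
open import Relation.Nullary using (Dec; yes; no; ¬?; contradiction)
open import Relation.Nullary.Decidable using (True; toWitness; from-yes; map′; _×-dec_; _⊎-dec_; _→-dec_)
open import Relation.Unary using (Decidable)

private
  variable
    k a b d w : ℕ

_≟ᵥ_ : (u v : Word a) → Dec (u ≡ v)
_≟ᵥ_ = ≡-dec Bool._≟_

word₀≡[] : (v : Word 0) → v ≡ []
word₀≡[] [] = refl

0ᵥ-++ : ∀ a b → 0ᵥ (a + b) ≡ 0ᵥ a ++ 0ᵥ b
0ᵥ-++ zero    b = refl
0ᵥ-++ (suc a) b = cong (false ∷_) (0ᵥ-++ a b)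

·ₛ-++ : ∀ s (u : Word a) (v : Word b) → s ·ₛ (u ++ v) ≡ (s ·ₛ u) ++ (s ·ₛ v)
·ₛ-++ {a} {b} false u v = 0ᵥ-++ a b
·ₛ-++         true  u v = refl

wt-++ : (u : Word a) (v : Word b) → wt (u ++ v) ≡ wt u + wt v
wt-++ []          v = refl
wt-++ (true ∷ u)  v = cong suc (wt-++ u v)
wt-++ (false ∷ u) v = wt-++ u v

⟨⟩-++ : (u u′ : Word a) (v v′ : Word b) → ⟨ u ++ v , u′ ++ v′ ⟩ ≡ ⟨ u , u′ ⟩ xor ⟨ v , v′ ⟩
⟨⟩-++ []      []        v v′ = refl
⟨⟩-++ (x ∷ u) (x′ ∷ u′) v v′ =
  trans (cong ((x ∧ x′) xor_) (⟨⟩-++ u u′ v v′)) (sym (xor-assoc (x ∧ x′) ⟨ u , u′ ⟩ ⟨ v , v′ ⟩))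

⊕-identityˡ : (v : Word a) → 0ᵥ a ⊕ v ≡ v
⊕-identityˡ []      = refl
⊕-identityˡ (x ∷ v) = cong (x ∷_) (⊕-identityˡ v)

comb-0ᵥ : (G : GenMatrix k a) → comb (0ᵥ k) G ≡ 0ᵥ a
comb-0ᵥ []      = refl
comb-0ᵥ (g ∷ G) = trans (⊕-identityˡ (comb (0ᵥ _) G)) (comb-0ᵥ G)

_++ᴳ_ : GenMatrix k a → GenMatrix k b → GenMatrix k (a + b)
_++ᴳ_ = zipWith _++_

copies : (m : ℕ) → GenMatrix k a → GenMatrix k (m * a)
copies zero    G = replicate _ []
copies (suc m) G = G ++ᴳ copies m G

comb-++ᴳ : (c : Word k) (G : GenMatrix k a) (H : GenMatrix k b) →
           comb c (G ++ᴳ H) ≡ comb c G ++ comb c H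
comb-++ᴳ {a = a} {b} [] [] [] = 0ᵥ-++ a b
comb-++ᴳ (s ∷ c) (g ∷ G) (h ∷ H) = begin
  (s ·ₛ (g ++ h)) ⊕ comb c (G ++ᴳ H)                ≡⟨ cong₂ _⊕_ (·ₛ-++ s g h) (comb-++ᴳ c G H) ⟩
  ((s ·ₛ g) ++ (s ·ₛ h)) ⊕ (comb c G ++ comb c H)  ≡⟨ zipWith-++ _xor_ (s ·ₛ g) (s ·ₛ h) (comb c G) (comb c H) ⟩
  ((s ·ₛ g) ⊕ comb c G) ++ ((s ·ₛ h) ⊕ comb c H)   ∎
  where open ≡-Reasoning

wt-comb-++ᴳ : (c : Word k) (G : GenMatrix k a) (H : GenMatrix k b) →
              wt (comb c (G ++ᴳ H)) ≡ wt (comb c G) + wt (comb c H)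
wt-comb-++ᴳ c G H = trans (cong wt (comb-++ᴳ c G H)) (wt-++ (comb c G) (comb c H))

⟨⟩-comb-++ᴳ : (c c′ : Word k) (G : GenMatrix k a) (H : GenMatrix k b) →
              ⟨ comb c (G ++ᴳ H) , comb c′ (G ++ᴳ H) ⟩ ≡ ⟨ comb c G , comb c′ G ⟩ xor ⟨ comb c H , comb c′ H ⟩
⟨⟩-comb-++ᴳ c c′ G H =
  trans (cong₂ ⟨_,_⟩ (comb-++ᴳ c G H) (comb-++ᴳ c′ G H)) (⟨⟩-++ (comb c G) (comb c′ G) (comb c H) (comb c′ H))

MinWeight : GenMatrix k a → ℕ → Set
MinWeight {k} G d =
  (∃ λ c → c ≢ 0ᵥ k × wt (comb c G) ≡ d) × (∀ c → c ≢ 0ᵥ k → d ≤ wt (comb c G))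

ConstantWeight : GenMatrix k a → ℕ → Set
ConstantWeight {k} G w = ∀ c → c ≢ 0ᵥ k → wt (comb c G) ≡ w

SelfOrthogonal : GenMatrix k a → Set
SelfOrthogonal {k} G = ∀ (c c′ : Word k) → ⟨ comb c G , comb c′ G ⟩ ≡ false

-- The Gram matrix G Gᵀ is nonsingular.
NonDegenerate : GenMatrix k a → Set
NonDegenerate {k} G = ∀ c → c ≢ 0ᵥ k → ∃ λ c′ → ⟨ comb c G , comb c′ G ⟩ ≡ true

linIndep∧minWeight⇒minDist : {G : GenMatrix k a} → LinIndep G → MinWeight G d → MinDist G d
linIndep∧minWeight⇒minDist {G = G} indep ((c , c≢0 , wt≡d) , lower) =
  (comb c G , (c , refl) , c≢0 ∘ indep c , wt≡d) ,
  λ { _ (c , refl) x≢0 → lower c λ { refl → x≢0 (comb-0ᵥ G) } }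

nonDegenerate⇒isLCD : {G : GenMatrix k a} → NonDegenerate G → IsLCD G
nonDegenerate⇒isLCD {k} {G = G} nondeg _ (c , refl) x⊥ with c ≟ᵥ 0ᵥ k
... | yes refl = comb-0ᵥ G
... | no c≢0   with nondeg c c≢0
...   | c′ , ⟨x,c′⟩≡true = contradiction (trans (sym ⟨x,c′⟩≡true) (x⊥ _ (c′ , refl))) λ ()

module _ {G : GenMatrix k a} {H : GenMatrix k b} where

  linIndep-++ᴳ : LinIndep G → LinIndep (G ++ᴳ H)
  linIndep-++ᴳ indep c cGH≡0 = indep c (++-injectiveˡ (comb c G) (0ᵥ a)
    (trans (sym (comb-++ᴳ c G H)) (trans cGH≡0 (0ᵥ-++ a b))))

  minWeight-++ᴳ : MinWeight G d → ConstantWeight H w → MinWeight (G ++ᴳ H) (d + w)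
  minWeight-++ᴳ {d} {w} ((c , c≢0 , wt≡d) , lower) const =
    (c , c≢0 , trans (wt-comb-++ᴳ c G H) (cong₂ _+_ wt≡d (const c c≢0))) ,
    λ c c≢0 → subst (d + w ≤_) (sym (wt-comb-++ᴳ c G H))
                    (+-mono-≤ (lower c c≢0) (≤-reflexive (sym (const c c≢0))))

  constantWeight-++ᴳ : ConstantWeight G d → ConstantWeight H w → ConstantWeight (G ++ᴳ H) (d + w)
  constantWeight-++ᴳ constG constH c c≢0 =
    trans (wt-comb-++ᴳ c G H) (cong₂ _+_ (constG c c≢0) (constH c c≢0))

  selfOrthogonal-++ᴳ : SelfOrthogonal G → SelfOrthogonal H → SelfOrthogonal (G ++ᴳ H)
  selfOrthogonal-++ᴳ orthG orthH c c′ =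
    trans (⟨⟩-comb-++ᴳ c c′ G H) (cong₂ _xor_ (orthG c c′) (orthH c c′))

  nonDegenerate-++ᴳ : NonDegenerate G → SelfOrthogonal H → NonDegenerate (G ++ᴳ H)
  nonDegenerate-++ᴳ nondeg orthH c c≢0 with nondeg c c≢0
  ... | c′ , ⟨c,c′⟩≡true =
    c′ , trans (⟨⟩-comb-++ᴳ c c′ G H) (cong₂ _xor_ ⟨c,c′⟩≡true (orthH c c′))

constantWeight-copies : ∀ m {H : GenMatrix k a} → ConstantWeight H w → ConstantWeight (copies m H) (m * w)
constantWeight-copies zero {H} const c _ = cong wt (word₀≡[] (comb c (copies zero H)))
constantWeight-copies (suc m)     const   = constantWeight-++ᴳ const (constantWeight-copies m const)

selfOrthogonal-copies : ∀ m {H : GenMatrix k a} → SelfOrthogonal H → SelfOrthogonal (copies m H)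
selfOrthogonal-copies zero {H} orth c c′ =
  cong₂ ⟨_,_⟩ (word₀≡[] (comb c (copies zero H))) (word₀≡[] (comb c′ (copies zero H)))
selfOrthogonal-copies (suc m)     orth = selfOrthogonal-++ᴳ orth (selfOrthogonal-copies m orth)

∀? : {P : Word k → Set} → Decidable P → Dec (∀ c → P c)
∀? {zero} P? = map′ (λ { p [] → p }) (λ ∀P → ∀P []) (P? [])
∀? {suc k} P? =
  map′ (λ { (p , q) (false ∷ c) → p c ; (p , q) (true ∷ c) → q c })
       (λ ∀P → (λ c → ∀P (false ∷ c)) , (λ c → ∀P (true ∷ c)))
       (∀? (P? ∘ (false ∷_)) ×-dec ∀? (P? ∘ (true ∷_)))

∃? : {P : Word k → Set} → Decidable P → Dec (∃ P)
∃? {zero} P? = map′ ([] ,_) (λ { ([] , p) → p }) (P? [])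
∃? {suc k} P? =
  map′ [ (λ { (c , p) → false ∷ c , p }) , (λ { (c , p) → true ∷ c , p }) ]′
       (λ { (false ∷ c , p) → inj₁ (c , p) ; (true ∷ c , p) → inj₂ (c , p) })
       (∃? (P? ∘ (false ∷_)) ⊎-dec ∃? (P? ∘ (true ∷_)))

module _ (G : GenMatrix k a) where

  linIndep? : Dec (LinIndep G)
  linIndep? = ∀? λ c → comb c G ≟ᵥ 0ᵥ a →-dec c ≟ᵥ 0ᵥ k

  minWeight? : ∀ d → Dec (MinWeight G d)
  minWeight? d = ∃? (λ c → ¬? (c ≟ᵥ 0ᵥ k) ×-dec wt (comb c G) ℕ.≟ d)
           ×-dec ∀? (λ c → ¬? (c ≟ᵥ 0ᵥ k) →-dec d ℕ.≤? wt (comb c G))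

  constantWeight? : ∀ w → Dec (ConstantWeight G w)
  constantWeight? w = ∀? λ c → ¬? (c ≟ᵥ 0ᵥ k) →-dec wt (comb c G) ℕ.≟ w

  selfOrthogonal? : Dec (SelfOrthogonal G)
  selfOrthogonal? = ∀? λ c → ∀? λ c′ → ⟨ comb c G , comb c′ G ⟩ Bool.≟ false

  nonDegenerate? : Dec (NonDegenerate G)
  nonDegenerate? = ∀? λ c → ¬? (c ≟ᵥ 0ᵥ k) →-dec ∃? λ c′ → ⟨ comb c G , comb c′ G ⟩ Bool.≟ true

simplex : GenMatrix 3 7
simplex = (false ∷ false ∷ false ∷ true  ∷ true  ∷ true  ∷ true  ∷ [])
        ∷ (false ∷ true  ∷ true  ∷ false ∷ false ∷ true  ∷ true  ∷ [])
        ∷ (true  ∷ false ∷ true  ∷ false ∷ true  ∷ false ∷ true  ∷ [])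
        ∷ []

record SeedCode (b d : ℕ) : Set where
  field
    generator     : GenMatrix 3 b
    linIndep      : LinIndep generator
    minWeight     : MinWeight generator d
    nonDegenerate : NonDegenerate generator

seedCode : (G : GenMatrix 3 b) (d : ℕ) →
           {True (linIndep? G ×-dec minWeight? G d ×-dec nonDegenerate? G)} → SeedCode b d
seedCode G d {checked} with toWitness checked
... | indep , minW , nondeg = record
  { generator = G ; linIndep = indep ; minWeight = minW ; nonDegenerate = nondeg }

seed₄ : SeedCode 4 1
seed₄ = seedCode ( (false ∷ false ∷ false ∷ true  ∷ [])
                 ∷ (false ∷ true  ∷ true  ∷ false ∷ [])
                 ∷ (true  ∷ false ∷ true  ∷ false ∷ [])
                 ∷ []) 1

seed₆ : SeedCode 6 2
seed₆ = seedCode ( (false ∷ false ∷ false ∷ false ∷ true  ∷ true  ∷ [])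
                 ∷ (false ∷ false ∷ false ∷ true  ∷ false ∷ true  ∷ [])
                 ∷ (true  ∷ true  ∷ true  ∷ false ∷ false ∷ false ∷ [])
                 ∷ []) 2

seed₈ : SeedCode 8 3
seed₈ = seedCode ( (false ∷ false ∷ false ∷ false ∷ false ∷ true  ∷ true  ∷ true  ∷ [])
                 ∷ (false ∷ false ∷ false ∷ true  ∷ true  ∷ false ∷ false ∷ true  ∷ [])
                 ∷ (true  ∷ true  ∷ true  ∷ false ∷ false ∷ false ∷ true  ∷ false ∷ [])
                 ∷ []) 3

simplex-constantWeight : ConstantWeight simplex 4
simplex-constantWeight = from-yes (constantWeight? simplex 4)

simplex-selfOrthogonal : SelfOrthogonal simplex
simplex-selfOrthogonal = from-yes (selfOrthogonal? simplex)

extendBySimplices : SeedCode b d → ∀ m → Σ (GenMatrix 3 (b + m * 7)) (IsLCDCode (b + m * 7) 3 (d + m * 4))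
extendBySimplices {b} {d} seed m =
  G , indep , linIndep∧minWeight⇒minDist indep minW , nonDegenerate⇒isLCD nondeg
  where
  open SeedCode seed
  G : GenMatrix 3 (b + m * 7)
  G = generator ++ᴳ copies m simplex
  indep : LinIndep G
  indep = linIndep-++ᴳ linIndep
  minW : MinWeight G (d + m * 4)
  minW = minWeight-++ᴳ minWeight (constantWeight-copies m simplex-constantWeight)
  nondeg : NonDegenerate G
  nondeg = nonDegenerate-++ᴳ nonDegenerate (selfOrthogonal-copies m simplex-selfOrthogonal)

[a*[b+k*n]]/n≡[a*b]/n+k*a : ∀ a b k n .{{_ : NonZero n}} → (a * (b + k * n)) / n ≡ (a * b) / n + k * a
[a*[b+k*n]]/n≡[a*b]/n+k*a a b k n = begin
  (a * (b + k * n)) / n       ≡⟨ cong (_/ n) (*-distribˡ-+ a b (k * n)) ⟩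
  (a * b + a * (k * n)) / n   ≡⟨ cong (λ x → (a * b + x) / n) a*[k*n]≡k*a*n ⟩
  (a * b + k * a * n) / n     ≡⟨ +-distrib-/-∣ʳ (a * b) (divides-refl (k * a)) ⟩
  (a * b) / n + k * a * n / n ≡⟨ cong ((a * b) / n +_) (m*n/n≡m (k * a) n) ⟩
  (a * b) / n + k * a         ∎
  where
  open ≡-Reasoning
  a*[k*n]≡k*a*n : a * (k * n) ≡ k * a * n
  a*[k*n]≡k*a*n = trans (sym (*-assoc a k n)) (cong (_* n) (*-comm a k))

m%n≡r⇒m≡r+[m/n]*n : ∀ m n {r} .{{_ : NonZero n}} → m % n ≡ r → m ≡ r + (m / n) * n
m%n≡r⇒m≡r+[m/n]*n m n m%n≡r = trans (m≡m%n+[m/n]*n m n) (cong (_+ (m / n) * n) m%n≡r)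

lcdCodeOfLength : SeedCode b d → (4 * b) / 7 ≡ suc d →
                  ∀ {n} m → n ≡ b + m * 7 → Σ (GenMatrix 3 n) λ G → IsLCDCode n 3 ((4 * n) / 7 ∸ 1) G
lcdCodeOfLength {b} {d} seed 4b/7≡1+d m refl with extendBySimplices seed m
... | G , isLCDCode = G , subst (λ e → IsLCDCode _ 3 e G) (sym distance) isLCDCode
  where
  distance : (4 * (b + m * 7)) / 7 ∸ 1 ≡ d + m * 4
  distance = cong (_∸ 1) (trans ([a*[b+k*n]]/n≡[a*b]/n+k*a 4 b m 7) (cong (_+ m * 4) 4b/7≡1+d))

lemma5p13 : (n : ℕ) → 4 ≤ n → (n % 7 ≡ 1 ⊎ n % 7 ≡ 4 ⊎ n % 7 ≡ 6) →
    Σ (GenMatrix 3 n) λ G → IsLCDCode n 3 ((4 * n) / 7 ∸ 1) G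
lemma5p13 n 4≤n (inj₁ n%7≡1) with n / 7 | m%n≡r⇒m≡r+[m/n]*n n 7 n%7≡1
... | zero  | refl      = contradiction 4≤n λ { (s≤s ()) }
... | suc m | n≡8+m*7   = lcdCodeOfLength seed₈ refl m n≡8+m*7
lemma5p13 n 4≤n (inj₂ (inj₁ n%7≡4)) = lcdCodeOfLength seed₄ refl (n / 7) (m%n≡r⇒m≡r+[m/n]*n n 7 n%7≡4)
lemma5p13 n 4≤n (inj₂ (inj₂ n%7≡6)) = lcdCodeOfLength seed₆ refl (n / 7) (m%n≡r⇒m≡r+[m/n]*n n 7 n%7≡6)
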